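{- Over an alphabet with at least three characters, the non self-referencing LZ77 factorization size $\mathit{z}_{77}$ satisfies: $\liminf_{n\to\infty}\mathsf{MS}_{\mathrm{sub}}(\mathit{z}_{77},n)\ge 2$ and $\mathsf{AS}_{\mathrm{sub}}(\mathit{z}_{77},n)\ge \mathit{z}_{77}-1$; $\liminf_{n\to\infty}\mathsf{MS}_{\mathrm{ins}}(\mathit{z}_{77},n)\ge 2$ and $\mathsf{AS}_{\mathrm{ins}}(\mathit{z}_{77},n)\ge \mathit{z}_{77}-1$; $\liminf_{n\to\infty}\mathsf{MS}_{\mathrm{del}}(\mathit{z}_{77},n)\ge 2$ and $\mathsf{AS}_{\mathrm{del}}(\mathit{z}_{77},n)\ge \mathit{z}_{77}-2$. Here an additive bound $\mathsf{AS}_{\mathrm{x}}(\mathit{z}_{77},n)\ge \mathit{z}_{77}-c$ means: there are strings $T$ of arbitrarily large length with $\mathit{z}_{77}(T)$ arbitrarily large, each with a string $T'$ obtained from $T$ by one edit of type $\mathrm{x}$, such that $\mathit{z}_{77}(T')-\mathit{z}_{77}(T)\ge \mathit{z}_{77}(T)-c$.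
   Context: The non self-referencing LZ77 factorization of a nonempty string $T$ is $T=f_1\cdots f_z$ defined greedily left to right: for each $i$, let $u$ be the longest prefix of $f_i\cdots f_z$ (the remaining suffix) that occurs as a substring of $f_1\cdots f_{i-1}$; if $u$ is the whole remaining suffix then $f_i=u$ is the last factor, otherwise $f_i=uc$ where $c$ is the next character. $\mathit{z}_{77}(T)=z$. $\mathsf{ed}$ is edit distance; $\mathsf{MS}_{\mathrm{sub}}(C,n)=\sup\{C(T')/C(T):T\in\Sigma^n,T'\in\Sigma^n,\mathsf{ed}(T,T')=1\}$, with $T'\in\Sigma^{n+1}$ for ins and $T'\in\Sigma^{n-1}$ for del. -}

module Defs where

open import Data.Nat using (ℕ; zero; suc; _+_; _*_; _≤_; _⊔_; _⊓_)
open import Data.Bool using (Bool; true; false; if_then_else_; _∧_; _∨_)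
open import Data.List using (List; []; _∷_; _++_; length; take; drop)
open import Data.Fin using (Fin)
open import Data.Fin.Properties using (_≟_)
open import Data.Product using (Σ; ∃; _×_; _,_)
open import Relation.Nullary.Decidable using (⌊_⌋)
open import Relation.Binary.PropositionalEquality using (_≡_)

Str : ℕ → Set
Str k = List (Fin k)

module _ {k : ℕ} where

  _==_ : Fin k → Fin k → Bool
  a == b = ⌊ a ≟ b ⌋

  isPrefix : Str k → Str k → Bool
  isPrefix []       _        = true
  isPrefix (_ ∷ _)  []       = false
  isPrefix (a ∷ u)  (b ∷ w)  = (a == b) ∧ isPrefix u w

  isInfix : Str k → Str k → Bool
  isInfix u []       = isPrefix u []
  isInfix u (b ∷ w)  = isPrefix u (b ∷ w) ∨ isInfix u w

  longestFrom : Str k → Str k → ℕ → ℕ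
  longestFrom P S zero    = zero
  longestFrom P S (suc i) =
    if isInfix (take (suc i) S) P then suc i else longestFrom P S i

  longestPrefixIn : Str k → Str k → ℕ
  longestPrefixIn P S = longestFrom P S (length S)

  -- Number of factors of the greedy non self-referencing LZ77 factorization of
  -- the remaining suffix S, given the already-factorized prefix P.
  -- The first argument is fuel; every step consumes at least one character,
  -- so fuel = length S suffices.
  lzCount : ℕ → Str k → Str k → ℕ
  lzCount _        P []        = zero
  lzCount zero     P (_ ∷ _)   = zero
  lzCount (suc f)  P (c ∷ S)   with longestPrefixIn P (c ∷ S)
  ... | l = if ⌊ l Data.Nat.≟ length (c ∷ S) ⌋
              then 1
              else suc (lzCount f (P ++ take (suc l) (c ∷ S))
                                  (drop (suc l) (c ∷ S)))

  z77 : Str k → ℕ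
  z77 T = lzCount (length T) [] T

  ed : Str k → Str k → ℕ
  ed []       ys       = length ys
  ed (x ∷ xs) []       = length (x ∷ xs)
  ed (x ∷ xs) (y ∷ ys) =
    (ed xs ys + (if x == y then 0 else 1))
      ⊓ suc (ed xs (y ∷ ys) ⊓ ed (x ∷ xs) ys)

data EditKind : Set where
  sub ins del : EditKind

LenOK : EditKind → ℕ → ℕ → Set
LenOK sub n n' = n' ≡ n
LenOK ins n n' = n' ≡ suc n
LenOK del n n' = suc n' ≡ n

OneEdit : {k : ℕ} → EditKind → Str k → Str k → Set
OneEdit x T T' = ed T T' ≡ 1 × LenOK x (length T) (length T')

-- liminf_{n→∞} MS_x(z77, n) ≥ 2, with MS_x(z77,n) = sup z77(T')/z77(T) over
-- T ∈ Σ^n and T' with OneEdit x T T'.  Encoded without reals as: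
-- for every m, for all sufficiently large n there are such T, T' with
-- z77(T')/z77(T) ≥ 2 - 1/(m+1), i.e. (m+1)·z77(T') ≥ (2m+1)·z77(T).
LiminfMSGe2 : (k : ℕ) → EditKind → Set
LiminfMSGe2 k x =
  (m : ℕ) → Σ ℕ λ N → (n : ℕ) → N ≤ n →
    Σ (Str k) λ T → Σ (Str k) λ T' →
      length T ≡ n × OneEdit x T T' ×
      (2 * m + 1) * z77 T ≤ (m + 1) * z77 T'

-- AS_x(z77, n) ≥ z77 - c: there are strings T of arbitrarily large length with
-- z77(T) arbitrarily large, each with T' obtained by one edit of kind x such that
-- z77(T') - z77(T) ≥ z77(T) - c  (over the integers, i.e. 2·z77(T) ≤ z77(T') + c).
ASGe : (k : ℕ) → EditKind → ℕ → Set
ASGe k x c =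
  (L M : ℕ) → Σ (Str k) λ T → Σ (Str k) λ T' →
    L ≤ length T × M ≤ z77 T × OneEdit x T T' ×
    2 * z77 T ≤ z77 T' + c

-- Let T₀ = a and T_{i+1} = T_i T_i b, and write T_i = a R_i.  The LZ77 factorization of
-- T_{d+1} is  a | T₀b | T₁b | ⋯ | T_d b,  and appending a prefix ρ of T_{d+1} adds at most one
-- more factor, so z₇₇(T_{d+1} ρ) ≤ d + 3.  Editing the leading a (substituting c, inserting c
-- after it, or deleting it) breaks this self-reference: in the edited text every block
-- T_{i+1} b = T_i · a R_i · b b contains two substrings that occur nowhere before, T_i a
-- (T_i is unbordered) and R_i b b (it ends with b^{i+2}), hence two factor ends, so
-- z₇₇ ≥ 2d + 2.  Letting |ρ| range over [0, |T_{d+1}|] yields witnesses of every large length.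

module Submission where

open import Defs
open import Data.Nat using (ℕ; zero; suc; _+_; _*_; _∸_; _≤_; _≤′_; ≤′-reflexive; ≤′-step; _<_; z≤n; s≤s; s≤s⁻¹; _⊓_)
open import Data.Nat.Properties
open import Data.Nat.Tactic.RingSolver using (solve-∀)
open import Data.List using ([]; _∷_; _++_; length; take; drop; replicate; [_])
open import Data.List.Properties
  using (take-all; ++-assoc; length-++; length-take; take++drop≡id; ++-identityʳ;
         length-replicate; ∷-injective; ∷ʳ-injectiveˡ; ++-cancelˡ; ++-monoid)
open import Data.Fin using (Fin)
import Data.Fin as Fin
open import Data.Fin.Properties using () renaming (_≟_ to _≟ᶠ_)
open import Data.Bool using (true; false; if_then_else_; _∨_)
open import Data.Bool.Properties using (∨-zeroʳ)
open import Data.Product using (Σ; _,_; proj₁; proj₂; _×_)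
open import Data.Sum using (_⊎_; inj₁; inj₂)
open import Data.Empty using (⊥; ⊥-elim)
open import Relation.Nullary using (¬_; yes; no)
open import Relation.Nullary.Decidable using (isYes≗does; dec-true; dec-false)
open import Function using (_∘_)
open import Relation.Binary.PropositionalEquality hiding ([_])
open import Tactic.MonoidSolver using (solve)

module _ {k : ℕ} where

  private
    S : Set
    S = Str k

  Infix : S → S → Set
  Infix u v = Σ S λ X → Σ S λ Y → v ≡ X ++ u ++ Y

  ==⇒≡ : ∀ {x y : Fin k} → x == y ≡ true → x ≡ y
  ==⇒≡ {x} {y} e with x ≟ᶠ y
  ... | yes p = p

  ==-refl : ∀ (x : Fin k) → x == x ≡ true
  ==-refl x = trans (isYes≗does (x ≟ᶠ x)) (dec-true (x ≟ᶠ x) refl)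

  isPrefix-sound : ∀ (u w : S) → isPrefix u w ≡ true → Σ S λ Y → w ≡ u ++ Y
  isPrefix-sound []      w       e = w , refl
  isPrefix-sound (x ∷ u) (y ∷ w) e with x == y in x=y
  ... | true with isPrefix-sound u w e
  ... | Y , refl = Y , cong (_∷ u ++ Y) (sym (==⇒≡ x=y))

  isInfix-sound : ∀ (u v : S) → isInfix u v ≡ true → Infix u v
  isInfix-sound [] []      e = [] , [] , refl
  isInfix-sound u (y ∷ v) e with isPrefix u (y ∷ v) in pre
  ... | true  = [] , isPrefix-sound u (y ∷ v) pre
  ... | false with isInfix-sound u v e
  ...   | X , Y , refl = y ∷ X , Y , refl

  isPrefix-complete : ∀ (u Y : S) → isPrefix u (u ++ Y) ≡ true
  isPrefix-complete []      Y = refl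
  isPrefix-complete (x ∷ u) Y rewrite ==-refl x = isPrefix-complete u Y

  isInfix-complete : ∀ {u v : S} → Infix u v → isInfix u v ≡ true
  isInfix-complete {u} ([] , Y , refl) with u ++ Y | isPrefix-complete u Y
  ... | []    | e = e
  ... | _ ∷ _ | e rewrite e = refl
  isInfix-complete {u} (x ∷ X , Y , refl) =
    trans (cong (isPrefix u (x ∷ X ++ u ++ Y) ∨_) (isInfix-complete (X , Y , refl))) (∨-zeroʳ _)

  isInfix-false : ∀ {u v : S} → isInfix u v ≡ false → ¬ Infix u v
  isInfix-false e i with () ← trans (sym e) (isInfix-complete i)

  ¬Infix⇒isInfix-false : ∀ {u v : S} → ¬ Infix u v → isInfix u v ≡ false
  ¬Infix⇒isInfix-false {u} {v} ¬i with isInfix u v in occurs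
  ... | true  = ⊥-elim (¬i (isInfix-sound u v occurs))
  ... | false = refl

  Infix-length : ∀ {u v : S} → Infix u v → length u ≤ length v
  Infix-length {u} (X , Y , refl) = begin
    length u                    ≤⟨ m≤n+m (length u) (length X) ⟩
    length X + length u         ≤⟨ +-monoʳ-≤ (length X) (m≤m+n (length u) (length Y)) ⟩
    length X + (length u + length Y) ≡⟨ cong (length X +_) (length-++ u) ⟨
    length X + length (u ++ Y)  ≡⟨ length-++ X ⟨
    length (X ++ u ++ Y)        ∎
    where open ≤-Reasoning

  longer⇒¬Infix : ∀ {u v : S} → length v < length u → ¬ Infix u v
  longer⇒¬Infix v<u i = <⇒≱ v<u (Infix-length i)

  Infix-trans : ∀ {u v w : S} → Infix u v → Infix v w → Infix u w
  Infix-trans {u} (X , Y , refl) (X′ , Y′ , refl) = X′ ++ X , Y ++ Y′ , assoc X′ X u Y Y′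
    where
      assoc : ∀ (A B C D E : S) → A ++ (B ++ C ++ D) ++ E ≡ (A ++ B) ++ C ++ D ++ E
      assoc A B C D E = solve (++-monoid (Fin k))

  Infix-refl : ∀ (u : S) → Infix u u
  Infix-refl u = [] , [] , sym (++-identityʳ u)

  Infix-++ʳ : ∀ (u Y : S) → Infix u (u ++ Y)
  Infix-++ʳ u Y = [] , Y , refl

  Infix-++ˡ : ∀ (X u : S) → Infix u (X ++ u)
  Infix-++ˡ X u = X , [] , cong (X ++_) (sym (++-identityʳ u))

  Infix-∷⁻ : ∀ {u v : S} {x} → (∀ Y → x ∷ v ≢ u ++ Y) → Infix u (x ∷ v) → Infix u v
  Infix-∷⁻ ¬pre ([]    , Y , eq) = ⊥-elim (¬pre Y eq)
  Infix-∷⁻ ¬pre (_ ∷ X , Y , eq) = X , Y , proj₂ (∷-injective eq)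

  ++-split : ∀ (A B C D : S) → A ++ B ≡ C ++ D → length A ≤ length C →
             Σ S λ M → C ≡ A ++ M × B ≡ M ++ D
  ++-split []      B C       D eq le        = C , refl , eq
  ++-split (x ∷ A) B (y ∷ C) D eq (s≤s le) with refl , eq′ ← ∷-injective eq
    with M , e₁ , e₂ ← ++-split A B C D eq′ le = M , cong (x ∷_) e₁ , e₂

  ++-suffix : ∀ (X w Q B : S) → X ++ w ≡ Q ++ B → length B ≤ length w → Σ S λ M → w ≡ M ++ B
  ++-suffix X w Q B eq B≤w = proj₁ cut , proj₂ (proj₂ cut)
    where
      sameLength : length X + length w ≡ length Q + length B
      sameLength = trans (sym (length-++ X)) (trans (cong length eq) (length-++ Q))
      X≤Q : length X ≤ length Q
      X≤Q = +-cancelʳ-≤ (length B) _ _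
              (≤-trans (+-monoʳ-≤ (length X) B≤w) (≤-reflexive sameLength))
      cut : Σ S λ M → Q ≡ X ++ M × w ≡ M ++ B
      cut = ++-split X w Q B eq X≤Q

  ++-longer⇒nonempty : ∀ (A B : S) → length A < length (A ++ B) → 0 < length B
  ++-longer⇒nonempty A []      lt = ⊥-elim (<-irrefl (cong length (sym (++-identityʳ A))) lt)
  ++-longer⇒nonempty A (_ ∷ _) _  = s≤s z≤n

  Straddle : S → S → S → Set
  Straddle w X Y = Σ S λ w₁ → Σ S λ w₂ → Σ S λ X′ → Σ S λ Y′ →
    w ≡ w₁ ++ w₂ × 0 < length w₁ × 0 < length w₂ × X ≡ X′ ++ w₁ × Y ≡ w₂ ++ Y′

  Infix-++⁻ : ∀ (w X Y : S) → Infix w (X ++ Y) → Infix w X ⊎ Infix w Y ⊎ Straddle w X Y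
  Infix-++⁻ w X Y (A , B , eq) with ≤-<-connex (length X) (length A)
  ... | inj₁ X≤A with M , _ , Y≡ ← ++-split X Y A (w ++ B) eq X≤A = inj₂ (inj₁ (M , B , Y≡))
  ... | inj₂ A<X with M , X≡ , wB≡ ← ++-split A (w ++ B) X Y (sym eq) (<⇒≤ A<X)
    with ≤-<-connex (length w) (length M)
  ...   | inj₁ w≤M with M′ , M≡ , _ ← ++-split w B M Y wB≡ w≤M =
            inj₁ (A , M′ , trans X≡ (cong (A ++_) M≡))
  ...   | inj₂ M<w with w₂ , w≡ , Y≡ ← ++-split M Y w B (sym wB≡) (<⇒≤ M<w) =
            inj₂ (inj₂ (M , w₂ , A , B , w≡ ,
              ++-longer⇒nonempty A M (subst (length A <_) (cong length X≡) A<X) ,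
              ++-longer⇒nonempty M w₂ (subst (length M <_) (cong length w≡) M<w) , X≡ , Y≡))

  take-length-++ : ∀ (F D : S) → take (length F) (F ++ D) ≡ F
  take-length-++ []      D = refl
  take-length-++ (x ∷ F) D = cong (x ∷_) (take-length-++ F D)

  drop-length-++ : ∀ (F D : S) → drop (length F) (F ++ D) ≡ D
  drop-length-++ []      D = refl
  drop-length-++ (x ∷ F) D = drop-length-++ F D

  private
    if-true : ∀ {A : Set} {b} {x y : A} → b ≡ true → (if b then x else y) ≡ x
    if-true refl = refl

    if-false : ∀ {A : Set} {b} {x y : A} → b ≡ false → (if b then x else y) ≡ y
    if-false refl = refl

  longestFrom-≤ : ∀ (P T : S) i → longestFrom P T i ≤ i
  longestFrom-≤ P T zero    = z≤n
  longestFrom-≤ P T (suc i) with isInfix (take (suc i) T) P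
  ... | true  = ≤-refl
  ... | false = m≤n⇒m≤1+n (longestFrom-≤ P T i)

  longestFrom-Infix : ∀ (P T : S) i → Infix (take (longestFrom P T i) T) P
  longestFrom-Infix P T zero    = [] , P , refl
  longestFrom-Infix P T (suc i) with isInfix (take (suc i) T) P in occurs
  ... | true  = isInfix-sound _ _ occurs
  ... | false = longestFrom-Infix P T i

  longestPrefixIn-Infix : ∀ {P T : S} → Infix T P → longestPrefixIn P T ≡ length T
  longestPrefixIn-Infix {P} {[]}    i = refl
  longestPrefixIn-Infix {P} {x ∷ T} i = if-true (isInfix-complete
    (subst (λ t → Infix (x ∷ t) P) (sym (take-all (length T) T ≤-refl)) i))

  longestFrom-self : ∀ (P Y : S) t → length P + t ≤ length (P ++ Y) →
                     longestFrom P (P ++ Y) (length P + t) ≡ length P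
  longestFrom-self []      Y zero    le = refl
  longestFrom-self (x ∷ P) Y zero    le rewrite +-identityʳ (length P) | take-length-++ P Y =
    if-true (isInfix-complete (Infix-refl (x ∷ P)))
  longestFrom-self P       Y (suc t) le rewrite +-suc (length P) t =
    trans (if-false (¬Infix⇒isInfix-false {v = P} (longer⇒¬Infix P<taken)))
          (longestFrom-self P Y t (≤-trans (n≤1+n _) le))
    where
      P<taken : length P < length (take (suc (length P + t)) (P ++ Y))
      P<taken = subst (length P <_) (sym (trans (length-take _ (P ++ Y)) (m≤n⇒m⊓n≡m le)))
                      (s≤s (m≤m+n (length P) t))

  longestFrom-[] : ∀ x (T : S) i → longestFrom [] (x ∷ T) i ≡ 0
  longestFrom-[] x T zero    = refl
  longestFrom-[] x T (suc i) = longestFrom-[] x T i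

  lzCount-factor : ∀ f (P : S) c (T F D : S) → c ∷ T ≡ F ++ D →
                   length F ≡ suc (longestPrefixIn P (c ∷ T)) →
                   lzCount (suc f) P (c ∷ T) ≡ suc (lzCount f (P ++ F) D)
  lzCount-factor f P c T F D split lenF =
    trans (if-false (trans (isYes≗does (l ≟ length (c ∷ T))) (dec-false (l ≟ length (c ∷ T)) l≢n)))
          (cong₂ (λ A B → suc (lzCount f (P ++ A) B))
                 (trans (cong (λ m → take m (c ∷ T)) (sym lenF))
                        (trans (cong (take (length F)) split) (take-length-++ F D)))
                 (trans (cong (λ m → drop m (c ∷ T)) (sym lenF))
                        (trans (cong (drop (length F)) split) (drop-length-++ F D))))
    where
      l = longestPrefixIn P (c ∷ T)
      l<n : l < length (c ∷ T)
      l<n = begin-strict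
        l                             <⟨ n<1+n l ⟩
        suc l                         ≡⟨ lenF ⟨
        length F                      ≤⟨ m≤m+n _ _ ⟩
        length F + length D           ≡⟨ length-++ F ⟨
        length (F ++ D)               ≡⟨ cong length split ⟨
        length (c ∷ T)                ∎
        where open ≤-Reasoning
      l≢n : l ≢ length (c ∷ T)
      l≢n = <⇒≢ l<n

  lzCount-occurring : ∀ f (P T : S) → length T ≤ f → Infix T P → lzCount f P T ≡ length T ⊓ 1
  lzCount-occurring f       P []      le i = refl
  lzCount-occurring (suc f) P (c ∷ T) le i =
    trans (if-true (trans (isYes≗does (l ≟ length (c ∷ T)))
                          (dec-true (l ≟ length (c ∷ T)) (longestPrefixIn-Infix i))))
          (cong suc (sym (⊓-zeroʳ (length T))))
    where l = longestPrefixIn P (c ∷ T)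

  length-take-≤ : ∀ {n} (T : S) → n ≤ length T → length (take n T) ≡ n
  length-take-≤ {n} T le = trans (length-take n T) (m≤n⇒m⊓n≡m le)

  -- A factor is a previously occurring string plus one character, so it cannot extend past
  -- the end of an occurrence of w x when w x does not occur in P.
  longestPrefixIn-fresh : ∀ (P α w : S) x γ → ¬ Infix (w ++ [ x ]) P →
                          longestPrefixIn P (α ++ w ++ x ∷ γ) ≤ length (α ++ w)
  longestPrefixIn-fresh P α w x γ ¬occ = ≮⇒≥ λ αw<l → ¬occ (wx-occurs αw<l)
    where
      T = α ++ w ++ x ∷ γ
      l = longestPrefixIn P T
      T≡ : T ≡ (α ++ w ++ [ x ]) ++ γ
      T≡ = solve (++-monoid (Fin k))
      αwx≤l : length (α ++ w) < l → length (α ++ w ++ [ x ]) ≤ length (take l T)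
      αwx≤l αw<l = begin
        length (α ++ w ++ [ x ])   ≡⟨ cong length (++-assoc α w [ x ]) ⟨
        length ((α ++ w) ++ [ x ]) ≡⟨ length-++ (α ++ w) ⟩
        length (α ++ w) + 1        ≡⟨ +-comm _ 1 ⟩
        suc (length (α ++ w))      ≤⟨ αw<l ⟩
        l                          ≡⟨ length-take-≤ T (longestFrom-≤ P T (length T)) ⟨
        length (take l T)          ∎
        where open ≤-Reasoning
      wx-occurs : length (α ++ w) < l → Infix (w ++ [ x ]) P
      wx-occurs αw<l with M , taken≡ , _ ← ++-split (α ++ w ++ [ x ]) γ (take l T) (drop l T)
                                             (trans (sym T≡) (sym (take++drop≡id l T))) (αwx≤l αw<l)
        = Infix-trans (Infix-++ˡ α (w ++ [ x ]))
            (Infix-trans (subst (Infix _) (sym taken≡) (Infix-++ʳ _ M)) (longestFrom-Infix P T (length T)))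

  -- FreshFactors P T r: T contains r disjoint, left-to-right occurrences of strings w x, each
  -- of which does not occur in the text before its last character.  Each of them contains
  -- the end of a factor, so r bounds the number of factors of T after P from below.
  data FreshFactors : S → S → ℕ → Set where
    []    : ∀ {P T} → FreshFactors P T 0
    fresh : ∀ {P T r} (α w : S) (x : Fin k) (γ : S) → T ≡ α ++ w ++ x ∷ γ →
            ¬ Infix (w ++ [ x ]) (P ++ α ++ w) →
            FreshFactors (P ++ α ++ w ++ [ x ]) γ r → FreshFactors P T (suc r)

  FreshFactors-shift : ∀ {r} (Q ρ γ : S) → FreshFactors (Q ++ ρ) γ r → FreshFactors Q (ρ ++ γ) r
  FreshFactors-shift Q ρ γ [] = []
  FreshFactors-shift Q ρ γ (fresh α w x γ′ γ≡ ¬occ ff) =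
    fresh (ρ ++ α) w x γ′ (trans (cong (ρ ++_) γ≡) (sym (++-assoc ρ α _)))
          (¬occ ∘ subst (Infix _) (sym (reassoc w)))
          (subst (λ P → FreshFactors P γ′ _) (reassoc (w ++ [ x ])) ff)
    where
      reassoc : ∀ Z → (Q ++ ρ) ++ α ++ Z ≡ Q ++ (ρ ++ α) ++ Z
      reassoc Z = solve (++-monoid (Fin k))

  ++-∷-≢[] : ∀ (α w : S) x γ → α ++ w ++ x ∷ γ ≢ []
  ++-∷-≢[] []      []      x γ ()
  ++-∷-≢[] []      (_ ∷ _) x γ ()
  ++-∷-≢[] (_ ∷ _) w       x γ ()

  lzCount-≥-FreshFactors : ∀ f (P T : S) r → FreshFactors P T r → length T ≤ f → r ≤ lzCount f P T
  lzCount-≥-FreshFactors f       P T       zero    [] le = z≤n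
  lzCount-≥-FreshFactors f       P []      (suc r) (fresh α w x γ T≡ _ _) le =
    ⊥-elim (++-∷-≢[] α w x γ (sym T≡))
  lzCount-≥-FreshFactors (suc f) P (c ∷ T) (suc r) (fresh α w x γ T≡ ¬occ ff) (s≤s le) =
    subst (suc r ≤_) (sym (lzCount-factor f P c T F D (sym (take++drop≡id (suc l) (c ∷ T))) lenF))
        (s≤s (lzCount-≥-FreshFactors f (P ++ F) D r ff′ D≤f))
    where
      l = longestPrefixIn P (c ∷ T)
      F = take (suc l) (c ∷ T)
      D = drop (suc l) (c ∷ T)
      l≤αw : l ≤ length (α ++ w)
      l≤αw = subst (λ t → longestPrefixIn P t ≤ length (α ++ w)) (sym T≡)
               (longestPrefixIn-fresh P α w x γ (¬occ ∘ λ i → Infix-trans i (Infix-++ʳ P (α ++ w))))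
      cT≡ : c ∷ T ≡ (α ++ w ++ [ x ]) ++ γ
      cT≡ = trans T≡ (solve (++-monoid (Fin k)))
      αwx≡αw+1 : length (α ++ w ++ [ x ]) ≡ suc (length (α ++ w))
      αwx≡αw+1 = trans (cong length (sym (++-assoc α w [ x ]))) (trans (length-++ (α ++ w)) (+-comm _ 1))
      αw<cT : length (α ++ w) < length (c ∷ T)
      αw<cT = begin-strict
        length (α ++ w)              <⟨ n<1+n _ ⟩
        suc (length (α ++ w))        ≡⟨ αwx≡αw+1 ⟨
        length (α ++ w ++ [ x ])     ≤⟨ m≤m+n _ (length γ) ⟩
        length (α ++ w ++ [ x ]) + length γ ≡⟨ length-++ (α ++ w ++ [ x ]) ⟨
        length ((α ++ w ++ [ x ]) ++ γ) ≡⟨ cong length cT≡ ⟨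
        length (c ∷ T)               ∎
        where open ≤-Reasoning
      lenF : length F ≡ suc l
      lenF = length-take-≤ (c ∷ T) (≤-<-trans l≤αw αw<cT)
      FD≡ : F ++ D ≡ (α ++ w ++ [ x ]) ++ γ
      FD≡ = trans (take++drop≡id (suc l) (c ∷ T)) cT≡
      F≤αwx : length F ≤ length (α ++ w ++ [ x ])
      F≤αwx = subst₂ _≤_ (sym lenF) (sym αwx≡αw+1) (s≤s l≤αw)
      cut : Σ S λ M → α ++ w ++ [ x ] ≡ F ++ M × D ≡ M ++ γ
      cut = ++-split F D (α ++ w ++ [ x ]) γ FD≡ F≤αwx
      M = proj₁ cut
      ff′ : FreshFactors (P ++ F) D r
      ff′ = subst (λ Z → FreshFactors (P ++ F) Z r) (sym (proj₂ (proj₂ cut)))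
              (FreshFactors-shift (P ++ F) M γ
                (subst (λ Q → FreshFactors Q γ r)
                       (trans (cong (P ++_) (proj₁ (proj₂ cut))) (sym (++-assoc P F M))) ff))
      T≡l+D : length T ≡ l + length D
      T≡l+D = suc-injective (trans (cong length (sym (take++drop≡id (suc l) (c ∷ T))))
                                   (trans (length-++ F) (cong (_+ length D) lenF)))
      D≤f : length D ≤ f
      D≤f = ≤-trans (m≤n+m (length D) l) (≤-trans (≤-reflexive (sym T≡l+D)) le)

  lzCount-repeat : ∀ f p (P Z : S) y → let P⁺ = p ∷ P in
                   lzCount (suc f) P⁺ (P⁺ ++ y ∷ Z) ≡ suc (lzCount f (P⁺ ++ P⁺ ++ [ y ]) Z)
  lzCount-repeat f p P Z y =
    lzCount-factor f P⁺ p (P ++ y ∷ Z) (P⁺ ++ [ y ]) Z (sym (++-assoc P⁺ [ y ] Z)) lenF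
    where
      P⁺ = p ∷ P
      lenP⁺yZ : length (P⁺ ++ y ∷ Z) ≡ length P⁺ + suc (length Z)
      lenP⁺yZ = length-++ P⁺
      lenF : length (P⁺ ++ [ y ]) ≡ suc (longestPrefixIn P⁺ (P⁺ ++ y ∷ Z))
      lenF = begin
        length (P⁺ ++ [ y ])   ≡⟨ length-++ P⁺ ⟩
        length P⁺ + 1          ≡⟨ +-comm _ 1 ⟩
        suc (length P⁺)        ≡⟨ cong suc (longestFrom-self P⁺ (y ∷ Z) (suc (length Z))
                                                           (≤-reflexive (sym lenP⁺yZ))) ⟨
        suc (longestFrom P⁺ (P⁺ ++ y ∷ Z) (length P⁺ + suc (length Z)))
                               ≡⟨ cong (suc ∘ longestFrom P⁺ (P⁺ ++ y ∷ Z)) lenP⁺yZ ⟨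
        suc (longestPrefixIn P⁺ (P⁺ ++ y ∷ Z)) ∎
        where open ≡-Reasoning

  ed-refl : ∀ (T : S) → ed T T ≡ 0
  ed-refl []      = refl
  ed-refl (x ∷ T) rewrite ed-refl T | ==-refl x = refl

  ed-insert-head : ∀ y (T : S) → ed T (y ∷ T) ≡ 1
  ed-insert-head y []      = refl
  ed-insert-head y (x ∷ T) = begin
    (ed T (x ∷ T) + B) ⊓ suc (ed T (y ∷ x ∷ T) ⊓ ed (x ∷ T) (x ∷ T))
      ≡⟨ cong₂ (λ p q → (p + B) ⊓ suc (ed T (y ∷ x ∷ T) ⊓ q)) (ed-insert-head x T) (ed-refl (x ∷ T)) ⟩
    (1 + B) ⊓ suc (ed T (y ∷ x ∷ T) ⊓ 0)
      ≡⟨ cong (λ q → (1 + B) ⊓ suc q) (⊓-zeroʳ (ed T (y ∷ x ∷ T))) ⟩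
    suc (B ⊓ 0)
      ≡⟨ cong suc (⊓-zeroʳ B) ⟩
    1 ∎
    where
      B = if x == y then 0 else 1
      open ≡-Reasoning

  ed-delete-head : ∀ x (T : S) → ed (x ∷ T) T ≡ 1
  ed-delete-head x []      = refl
  ed-delete-head x (y ∷ T) = begin
    (ed (y ∷ T) T + B) ⊓ suc (ed (y ∷ T) (y ∷ T) ⊓ ed (x ∷ y ∷ T) T)
      ≡⟨ cong₂ (λ p q → (p + B) ⊓ suc (q ⊓ ed (x ∷ y ∷ T) T)) (ed-delete-head y T) (ed-refl (y ∷ T)) ⟩
    suc (B ⊓ 0)
      ≡⟨ cong suc (⊓-zeroʳ B) ⟩
    1 ∎
    where
      B = if x == y then 0 else 1
      open ≡-Reasoning

  ed-substitute-head : ∀ {x y} (T : S) → x == y ≡ false → ed (x ∷ T) (y ∷ T) ≡ 1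
  ed-substitute-head {x} {y} T x≠y rewrite ed-refl T | x≠y = refl

  ed-insert-second : ∀ x y (T : S) → ed (x ∷ T) (x ∷ y ∷ T) ≡ 1
  ed-insert-second x y T rewrite ed-insert-head y T | ==-refl x = refl

  replicate-∷ʳ : ∀ n (y : Fin k) → replicate n y ++ [ y ] ≡ replicate (suc n) y
  replicate-∷ʳ zero    y = refl
  replicate-∷ʳ (suc n) y = cong (y ∷_) (replicate-∷ʳ n y)

  replicate-++⁻ : ∀ n y (w₁ w₂ : S) → replicate n y ≡ w₁ ++ w₂ →
                  w₁ ≡ replicate (length w₁) y × w₂ ≡ replicate (length w₂) y
  replicate-++⁻ n       y []       w₂ eq =
    refl , trans (sym eq) (cong (λ m → replicate m y) (trans (sym (length-replicate n)) (cong length eq)))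
  replicate-++⁻ (suc n) y (x ∷ w₁) w₂ eq with refl , eq′ ← ∷-injective eq
    with w₁≡ , w₂≡ ← replicate-++⁻ n y w₁ w₂ eq′ = cong (y ∷_) w₁≡ , w₂≡

  replicate-∈ : ∀ n y (w₁ : S) z (w₂ : S) → replicate n y ≡ w₁ ++ z ∷ w₂ → z ≡ y
  replicate-∈ n y w₁ z w₂ eq = proj₁ (∷-injective (proj₂ (replicate-++⁻ n y w₁ (z ∷ w₂) eq)))

  replicate-Infix-pred : ∀ {n y} {X : S} → Infix (replicate (suc n) y) X → Infix (replicate n y) X
  replicate-Infix-pred {n} {y} = Infix-trans (Infix-++ˡ [ y ] (replicate n y))

  replicate-Infix-++-∷ : ∀ n {y z} (X Y : S) → z ≢ y → Infix (replicate (suc n) y) (X ++ z ∷ Y) →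
                         Infix (replicate (suc n) y) X ⊎ Infix (replicate (suc n) y) Y
  replicate-Infix-++-∷ n {y} X Y z≢y i with Infix-++⁻ _ X (_ ∷ Y) i
  ... | inj₁ inX       = inj₁ inX
  ... | inj₂ (inj₁ inY) = inj₂ (Infix-∷⁻ (λ Y′ eq → z≢y (proj₁ (∷-injective eq))) inY)
  ... | inj₂ (inj₂ (w₁ , z′ ∷ w₂ , _ , _ , w≡ , _ , _ , _ , zY≡)) =
    ⊥-elim (z≢y (trans (proj₁ (∷-injective zY≡)) (replicate-∈ (suc n) y w₁ z′ w₂ w≡)))

  replicate-Infix-∷ʳ : ∀ n {y} (X : S) → Infix (replicate (suc n) y) (X ++ [ y ]) → Infix (replicate n y) X
  replicate-Infix-∷ʳ zero    X i = [] , X , refl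
  replicate-Infix-∷ʳ (suc n) X i with Infix-++⁻ _ X _ i
  ... | inj₁ inX = replicate-Infix-pred inX
  ... | inj₂ (inj₁ in[y]) with s≤s () ← Infix-length in[y]
  ... | inj₂ (inj₂ (w₁ , _ ∷ [] , X′ , _ , w≡ , _ , _ , X≡ , _)) =
    subst (λ w → Infix w X) w₁≡ (subst (Infix w₁) (sym X≡) (Infix-++ˡ X′ w₁))
    where
      w₁≡ : w₁ ≡ replicate (suc n) _
      w₁≡ = trans (proj₁ (replicate-++⁻ _ _ w₁ _ w≡))
                  (cong (λ m → replicate m _) (+-cancelʳ-≡ 1 _ _
                    (trans (sym (length-++ w₁)) (trans (cong length (sym w≡))
                      (trans (length-replicate (suc (suc n))) (+-comm 1 _))))))
  ... | inj₂ (inj₂ (_ , _ ∷ _ ∷ _ , _ , _ , _ , _ , _ , _ , ()))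

ratio-bound : ∀ m d → suc (4 * m) ≤ d → (2 * m + 1) * (3 + d) ≤ (m + 1) * (2 + (d + d))
ratio-bound m d le = subst (λ d → (2 * m + 1) * (3 + d) ≤ (m + 1) * (2 + (d + d))) (m+[n∸m]≡n le)
  (subst ((2 * m + 1) * (3 + (suc (4 * m) + t)) ≤_) (identity m t) (m≤m+n _ t))
  where
    t = d ∸ suc (4 * m)
    identity : ∀ m t → (2 * m + 1) * (3 + (suc (4 * m) + t)) + t
                     ≡ (m + 1) * (2 + ((suc (4 * m) + t) + (suc (4 * m) + t)))
    identity = solve-∀

module Construction (k : ℕ) where

  Word : Set
  Word = Str (3 + k)

  a b c : Fin (3 + k)
  a = Fin.zero
  b = Fin.suc Fin.zero
  c = Fin.suc (Fin.suc Fin.zero)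

  a≢b : a ≢ b
  a≢b ()

  a≢c : a ≢ c
  a≢c ()

  b≢c : b ≢ c
  b≢c ()

  T : ℕ → Word
  T zero    = [ a ]
  T (suc i) = T i ++ T i ++ [ b ]

  R : ℕ → Word
  R zero    = []
  R (suc i) = R i ++ T i ++ [ b ]

  T≡a∷R : ∀ i → T i ≡ a ∷ R i
  T≡a∷R zero    = refl
  T≡a∷R (suc i) rewrite T≡a∷R i = refl

  R-Infix-T : ∀ i → Infix (R i) (T i)
  R-Infix-T i = subst (Infix (R i)) (sym (T≡a∷R i)) (Infix-++ˡ [ a ] (R i))

  b^ : ℕ → Word
  b^ n = replicate n b

  R-endsWith-b^ : ∀ i → Σ Word λ Q → R i ≡ Q ++ b^ i
  R-endsWith-b^ zero = [] , refl
  R-endsWith-b^ (suc i) with Q , R≡ ← R-endsWith-b^ i = R i ++ a ∷ Q , (begin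
    R i ++ T i ++ [ b ]                ≡⟨ cong (λ t → R i ++ t ++ [ b ]) (T≡a∷R i) ⟩
    R i ++ (a ∷ R i) ++ [ b ]          ≡⟨ cong (λ t → R i ++ (a ∷ t) ++ [ b ]) R≡ ⟩
    R i ++ (a ∷ Q ++ b^ i) ++ [ b ]    ≡⟨ reassoc (R i) [ a ] Q (b^ i) [ b ] ⟩
    (R i ++ a ∷ Q) ++ b^ i ++ [ b ]    ≡⟨ cong ((R i ++ a ∷ Q) ++_) (replicate-∷ʳ i b) ⟩
    (R i ++ a ∷ Q) ++ b^ (suc i)       ∎)
    where
      open ≡-Reasoning
      reassoc : ∀ (X A Q B C : Word) → X ++ (A ++ Q ++ B) ++ C ≡ (X ++ A ++ Q) ++ B ++ C
      reassoc X A Q B C = solve (++-monoid (Fin (3 + k)))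

  T-endsWith-b^ : ∀ i → Σ Word λ Q → T i ≡ Q ++ b^ i
  T-endsWith-b^ i with Q , R≡ ← R-endsWith-b^ i = a ∷ Q , trans (T≡a∷R i) (cong (a ∷_) R≡)

  T-startsWith-aa : ∀ i → Σ Word λ Z → T (suc i) ≡ a ∷ a ∷ Z
  T-startsWith-aa zero = [ b ] , refl
  T-startsWith-aa (suc i) with Z , T≡ ← T-startsWith-aa i rewrite T≡ = _ , refl

  b^-∉-T : ∀ i → ¬ Infix (b^ (suc i)) (T i)
  b^-∉-T zero    = isInfix-false refl
  b^-∉-T (suc i) occ with replicate-Infix-++-∷ (suc i) (T i) (R i ++ [ b ]) a≢b
                            (subst (Infix _) (cong (λ t → T i ++ t ++ [ b ]) (T≡a∷R i)) occ)
  ... | inj₁ inT  = b^-∉-T i (replicate-Infix-pred inT)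
  ... | inj₂ inRb = b^-∉-T i (Infix-trans (replicate-Infix-∷ʳ (suc i) (R i) inRb) (R-Infix-T i))

  b^-∉-X-a-R : ∀ i (X : Word) → ¬ Infix (b^ (suc i)) X → ¬ Infix (b^ (suc i)) (X ++ a ∷ R i)
  b^-∉-X-a-R i X ∉X occ with replicate-Infix-++-∷ i X (R i) a≢b occ
  ... | inj₁ inX = ∉X inX
  ... | inj₂ inR = b^-∉-T i (Infix-trans inR (R-Infix-T i))

  b^-∉-TT : ∀ i → ¬ Infix (b^ (suc i)) (T i ++ T i)
  b^-∉-TT i = subst (λ t → ¬ Infix (b^ (suc i)) (T i ++ t)) (sym (T≡a∷R i)) (b^-∉-X-a-R i (T i) (b^-∉-T i))

  b^-∉-RT : ∀ i → ¬ Infix (b^ (suc i)) (R i ++ T i)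
  b^-∉-RT i = subst (λ t → ¬ Infix (b^ (suc i)) (R i ++ t)) (sym (T≡a∷R i))
                (b^-∉-X-a-R i (R i) (b^-∉-T i ∘ λ occ → Infix-trans occ (R-Infix-T i)))

  T-unbordered : ∀ j (X w Z : Word) → 0 < length X → 0 < length w →
                 T (suc j) ≡ X ++ w → T (suc j) ≡ w ++ Z → ⊥
  T-unbordered j X w Z 0<X 0<w T≡Xw T≡wZ with Q , T≡Qb ← T-endsWith-b^ (suc j)
    with suc j ≤? length w
  ... | yes long with M , w≡ ← ++-suffix X w Q (b^ (suc j)) (trans (sym T≡Xw) T≡Qb)
                               (subst (_≤ length w) (sym (length-replicate (suc j))) long)
    = b^-∉-TT j (inner (snoc-view Z 0<Z))
    where
      0<Z : 0 < length Z
      0<Z = subst (0 <_) (+-cancelʳ-≡ (length w) _ _ (begin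
              length X + length w ≡⟨ length-++ X ⟨
              length (X ++ w)     ≡⟨ cong length (trans (sym T≡Xw) T≡wZ) ⟩
              length (w ++ Z)     ≡⟨ length-++ w ⟩
              length w + length Z ≡⟨ +-comm (length w) _ ⟩
              length Z + length w ∎)) 0<X
        where open ≡-Reasoning
      snoc-view : ∀ (Y : Word) → 0 < length Y → Σ Word λ Y′ → Σ (Fin (3 + k)) λ y → Y ≡ Y′ ++ [ y ]
      snoc-view (y ∷ [])     _ = [] , y , refl
      snoc-view (y ∷ y′ ∷ Y) _ with Y′ , z , Y≡ ← snoc-view (y′ ∷ Y) (s≤s z≤n) = y ∷ Y′ , z , cong (y ∷_) Y≡
      inner : (Σ Word λ Z′ → Σ (Fin (3 + k)) λ z → Z ≡ Z′ ++ [ z ]) → Infix (b^ (suc j)) (T j ++ T j)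
      inner (Z′ , z , Z≡) = M , Z′ , ∷ʳ-injectiveˡ (T j ++ T j) (M ++ b^ (suc j) ++ Z′) (begin
        (T j ++ T j) ++ [ b ]          ≡⟨ ++-assoc (T j) (T j) [ b ] ⟩
        T (suc j)                      ≡⟨ T≡wZ ⟩
        w ++ Z                         ≡⟨ cong₂ _++_ w≡ Z≡ ⟩
        (M ++ b^ (suc j)) ++ Z′ ++ [ z ] ≡⟨ reassoc M (b^ (suc j)) Z′ [ z ] ⟩
        (M ++ b^ (suc j) ++ Z′) ++ [ z ] ∎)
        where
          open ≡-Reasoning
          reassoc : ∀ (A B C D : Word) → (A ++ B) ++ C ++ D ≡ (A ++ B ++ C) ++ D
          reassoc A B C D = solve (++-monoid (Fin (3 + k)))
  ... | no short with M , b^≡ ← ++-suffix Q (b^ (suc j)) X w (trans (sym T≡Qb) T≡Xw)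
                               (subst (length w ≤_) (sym (length-replicate (suc j))) (<⇒≤ (≰⇒> short)))
    with w
  ... | y ∷ w′ = a≢b (trans (proj₁ (∷-injective (trans (sym (T≡a∷R (suc j))) T≡wZ)))
                            (replicate-∈ (suc j) b M y w′ b^≡))

  T-border-Ta : ∀ j (X w Z : Word) → 0 < length X → 0 < length w →
                T (suc j) ≡ X ++ w → T (suc j) ++ [ a ] ≡ w ++ Z → ⊥
  T-border-Ta j X w Z 0<X 0<w T≡Xw Ta≡wZ =
    T-unbordered j X w (proj₁ cut) 0<X 0<w T≡Xw (proj₁ (proj₂ cut))
    where
      w≤T : length w ≤ length (T (suc j))
      w≤T = subst (length w ≤_) (trans (sym (length-++ X)) (cong length (sym T≡Xw))) (m≤n+m _ _)
      cut : Σ Word λ M → T (suc j) ≡ w ++ M × Z ≡ M ++ [ a ]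
      cut = ++-split w Z (T (suc j)) [ a ] (sym Ta≡wZ) w≤T

  T<Ta : ∀ i → length (T i) < length (T i ++ [ a ])
  T<Ta i = ≤-reflexive (sym (trans (length-++ (T i)) (+-comm _ 1)))

  R<Ta : ∀ i → length (R i) < length (T i ++ [ a ])
  R<Ta i = <-trans (≤-reflexive (sym (cong length (T≡a∷R i)))) (T<Ta i)

  R⁺T≡RTbT : ∀ i → R (suc i) ++ T i ≡ R i ++ T i ++ b ∷ T i
  R⁺T≡RTbT i = solve (++-monoid (Fin (3 + k)))

  Ta-∉-R⁺T : ∀ j → ¬ Infix (T (suc j) ++ [ a ]) (R (suc (suc j)) ++ T (suc j))
  Ta-∉-R⁺T j occ with Infix-++⁻ _ (R (suc j)) _ (subst (Infix _) (R⁺T≡RTbT (suc j)) occ)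
  ... | inj₁ inR = longer⇒¬Infix (R<Ta (suc j)) inR
  ... | inj₂ (inj₂ (w₁ , w₂ , X , _ , W≡ , 0<w₁ , _ , R≡ , _)) =
    T-border-Ta j (a ∷ X) w₁ w₂ (s≤s z≤n) 0<w₁ (trans (T≡a∷R (suc j)) (cong (a ∷_) R≡)) W≡
  ... | inj₂ (inj₁ inTbT) with Infix-++⁻ _ (T (suc j)) (b ∷ T (suc j)) inTbT
  ...   | inj₁ inT  = longer⇒¬Infix (T<Ta (suc j)) inT
  ...   | inj₂ (inj₁ inbT) = longer⇒¬Infix (T<Ta (suc j)) (Infix-∷⁻ b≢head inbT)
    where
      b≢head : ∀ Y → b ∷ T (suc j) ≢ (T (suc j) ++ [ a ]) ++ Y
      b≢head Y eq = a≢b (sym (proj₁ (∷-injective (trans eq (cong (λ t → (t ++ [ a ]) ++ Y) (T≡a∷R (suc j)))))))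
  ...   | inj₂ (inj₂ (w₁ , w₂ , [] , Y , W≡ , _ , _ , refl , bT≡)) =
    a≢b (sym (proj₁ (∷-injective (trans bT≡ (cong (_++ Y) (sym (++-cancelˡ (T (suc j)) [ a ] w₂ W≡)))))))
  ...   | inj₂ (inj₂ (w₁ , w₂ , x ∷ X , _ , W≡ , 0<w₁ , _ , T≡ , _)) =
    T-border-Ta j (x ∷ X) w₁ w₂ (s≤s z≤n) 0<w₁ T≡ W≡

  -- Each edit acts on the leading a of T (suc d) = a ∷ R (suc d).
  edited-head : EditKind → Word
  edited-head sub = [ c ]
  edited-head ins = a ∷ c ∷ []
  edited-head del = []

  edited-head-Infix⁻ : ∀ x {y₁ y₂} (w Y : Word) → y₁ ≢ c → y₂ ≢ c →
                       Infix (y₁ ∷ y₂ ∷ w) (edited-head x ++ Y) → Infix (y₁ ∷ y₂ ∷ w) Y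
  edited-head-Infix⁻ sub w Y y₁≢c y₂≢c =
    Infix-∷⁻ (λ _ eq → y₁≢c (sym (proj₁ (∷-injective eq))))
  edited-head-Infix⁻ ins w Y y₁≢c y₂≢c =
    Infix-∷⁻ (λ _ eq → y₁≢c (sym (proj₁ (∷-injective eq))))
    ∘ Infix-∷⁻ (λ _ eq → y₂≢c (sym (proj₁ (∷-injective (proj₂ (∷-injective eq))))))
  edited-head-Infix⁻ del w Y y₁≢c y₂≢c = λ occ → occ

  Ta-∉-edited : ∀ x i → ¬ Infix (T i ++ [ a ]) (edited-head x ++ R (suc i) ++ T i)
  Ta-∉-edited sub zero = isInfix-false refl
  Ta-∉-edited ins zero = isInfix-false refl
  Ta-∉-edited del zero = isInfix-false refl
  Ta-∉-edited x (suc j) occ with Z , T≡ ← T-startsWith-aa j =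
    Ta-∉-R⁺T j (subst (λ t → Infix t Y) (sym Ta≡)
      (edited-head-Infix⁻ x (Z ++ [ a ]) Y a≢c a≢c (subst (λ t → Infix t (edited-head x ++ Y)) Ta≡ occ)))
    where
      Y = R (suc (suc j)) ++ T (suc j)
      Ta≡ : T (suc j) ++ [ a ] ≡ a ∷ a ∷ Z ++ [ a ]
      Ta≡ = cong (_++ [ a ]) T≡

  b^-∉-edited : ∀ x j → ¬ Infix (b^ (suc (suc j))) (edited-head x ++ R (suc j) ++ T (suc j))
  b^-∉-edited x j = b^-∉-RT (suc j) ∘ edited-head-Infix⁻ x (b^ j) _ b≢c b≢c

  blocks : ℕ → ℕ → Word
  blocks j zero    = []
  blocks j (suc d) = (T j ++ [ b ]) ++ blocks (suc j) d

  R-blocks : ∀ d j → R (d + j) ≡ R j ++ blocks j d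
  R-blocks zero    j = sym (++-identityʳ (R j))
  R-blocks (suc d) j = trans (cong R (sym (+-suc d j)))
    (trans (R-blocks d (suc j)) (++-assoc (R j) (T j ++ [ b ]) (blocks (suc j) d)))

  T-blocks : ∀ d j → T (d + j) ≡ T j ++ blocks j d
  T-blocks zero    j = sym (++-identityʳ (T j))
  T-blocks (suc d) j = trans (cong T (sym (+-suc d j)))
    (trans (T-blocks d (suc j)) (++-assoc (T j) (T j ++ [ b ]) (blocks (suc j) d)))

  -- In the block T (i+1) b = T i · a R i · b b, both  T i a  and  R i b b  are fresh: the latter
  -- ends with b^(i+2), which occurs nowhere before.
  fresh-blocks : ∀ x d i (ρ : Word) →
                 FreshFactors (edited-head x ++ R (suc i)) (blocks (suc i) d ++ ρ) (d + d)
  fresh-blocks x zero    i ρ = []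
  fresh-blocks x (suc d) i ρ =
    fresh [] (T i) a (R i ++ b ∷ b ∷ rest) split₁ fresh₁
      (subst (FreshFactors P₁ (R i ++ b ∷ b ∷ rest)) (sym (+-suc d d))
        (fresh [] (R i ++ [ b ]) b rest (sym (++-assoc (R i) [ b ] (b ∷ rest))) fresh₂
          (subst (λ Q → FreshFactors Q rest (d + d)) P₂≡ (fresh-blocks x d (suc i) ρ))))
    where
      E = edited-head x
      P = E ++ R (suc i)
      rest = blocks (suc (suc i)) d ++ ρ
      P₁ = P ++ T i ++ [ a ]
      split₁ : blocks (suc i) (suc d) ++ ρ ≡ T i ++ a ∷ R i ++ b ∷ b ∷ rest
      split₁ = trans (cong (λ t → (((T i ++ t ++ [ b ]) ++ [ b ]) ++ blocks (suc (suc i)) d) ++ ρ) (T≡a∷R i))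
                     (reassoc (T i) [ a ] (R i) [ b ] (blocks (suc (suc i)) d) ρ)
        where
          reassoc : ∀ (T A R B D ρ : Word) →
                    (((T ++ (A ++ R) ++ B) ++ B) ++ D) ++ ρ ≡ T ++ A ++ R ++ B ++ B ++ D ++ ρ
          reassoc T A R B D ρ = solve (++-monoid (Fin (3 + k)))
      fresh₁ : ¬ Infix (T i ++ [ a ]) (P ++ T i)
      fresh₁ = Ta-∉-edited x i ∘ subst (Infix _) (++-assoc E (R (suc i)) (T i))
      b^-Infix-Rbb : Infix (b^ (suc (suc i))) ((R i ++ [ b ]) ++ [ b ])
      b^-Infix-Rbb with Q , R≡ ← R-endsWith-b^ i =
        subst (Infix _) (sym Rbb≡) (Infix-++ˡ Q (b^ (suc (suc i))))
        where
          Rbb≡ : (R i ++ [ b ]) ++ [ b ] ≡ Q ++ b^ (suc (suc i))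
          Rbb≡ = begin
            (R i ++ [ b ]) ++ [ b ]       ≡⟨ cong (λ r → (r ++ [ b ]) ++ [ b ]) R≡ ⟩
            ((Q ++ b^ i) ++ [ b ]) ++ [ b ] ≡⟨ solve (++-monoid (Fin (3 + k))) ⟩
            Q ++ (b^ i ++ [ b ]) ++ [ b ]  ≡⟨ cong (λ t → Q ++ t ++ [ b ]) (replicate-∷ʳ i b) ⟩
            Q ++ b^ (suc i) ++ [ b ]       ≡⟨ cong (Q ++_) (replicate-∷ʳ (suc i) b) ⟩
            Q ++ b^ (suc (suc i))          ∎
            where open ≡-Reasoning
      P₁Rb≡ : P₁ ++ R i ++ [ b ] ≡ E ++ R (suc i) ++ T (suc i)
      P₁Rb≡ = trans (reassoc E (R (suc i)) (T i) [ a ] (R i) [ b ])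
                    (cong (λ t → E ++ R (suc i) ++ T i ++ t ++ [ b ]) (sym (T≡a∷R i)))
        where
          reassoc : ∀ (E R′ T A R B : Word) → ((E ++ R′) ++ T ++ A) ++ R ++ B ≡ E ++ R′ ++ T ++ (A ++ R) ++ B
          reassoc E R′ T A R B = solve (++-monoid (Fin (3 + k)))
      fresh₂ : ¬ Infix ((R i ++ [ b ]) ++ [ b ]) (P₁ ++ R i ++ [ b ])
      fresh₂ = b^-∉-edited x i ∘ Infix-trans b^-Infix-Rbb ∘ subst (Infix _) P₁Rb≡
      P₂≡ : E ++ R (suc (suc i)) ≡ P₁ ++ (R i ++ [ b ]) ++ [ b ]
      P₂≡ = trans (cong (λ t → E ++ R (suc i) ++ (T i ++ t ++ [ b ]) ++ [ b ]) (T≡a∷R i))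
                  (reassoc E (R (suc i)) (T i) [ a ] (R i) [ b ])
        where
          reassoc : ∀ (E R′ T A R B : Word) →
                    E ++ R′ ++ (T ++ (A ++ R) ++ B) ++ B ≡ ((E ++ R′) ++ T ++ A) ++ (R ++ B) ++ B
          reassoc E R′ T A R B = solve (++-monoid (Fin (3 + k)))

  head-factors : EditKind → ℕ
  head-factors sub = 3
  head-factors ins = 3
  head-factors del = 2

  fresh-head : ∀ x (Z : Word) {r} → FreshFactors (edited-head x ++ R 1) Z r →
               FreshFactors [] (edited-head x ++ R 1 ++ Z) (head-factors x + r)
  fresh-head sub Z ff = fresh [] [] c (a ∷ b ∷ Z) refl (isInfix-false refl)
                          (fresh [] [] a (b ∷ Z) refl (isInfix-false refl)
                            (fresh [] [] b Z refl (isInfix-false refl) ff))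
  fresh-head ins Z ff = fresh [] [] a (c ∷ a ∷ b ∷ Z) refl (isInfix-false refl)
                          (fresh [] [] c (a ∷ b ∷ Z) refl (isInfix-false refl)
                            (fresh [] [ a ] b Z refl (isInfix-false refl) ff))
  fresh-head del Z ff = fresh [] [] a (b ∷ Z) refl (isInfix-false refl)
                          (fresh [] [] b Z refl (isInfix-false refl) ff)

  original : ℕ → Word → Word
  original d ρ = a ∷ R (suc d) ++ ρ

  edited : EditKind → ℕ → Word → Word
  edited x d ρ = edited-head x ++ R (suc d) ++ ρ

  one-edit : ∀ x d ρ → OneEdit x (original d ρ) (edited x d ρ)
  one-edit sub d ρ = ed-substitute-head (R (suc d) ++ ρ) refl , refl
  one-edit ins d ρ = ed-insert-second a c (R (suc d) ++ ρ) , refl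
  one-edit del d ρ = ed-delete-head a (R (suc d) ++ ρ) , refl

  z77-edited-≥ : ∀ x d ρ → head-factors x + (d + d) ≤ z77 (edited x d ρ)
  z77-edited-≥ x d ρ = lzCount-≥-FreshFactors _ [] _ _ (subst (λ t → FreshFactors [] t _) (sym edited≡)
                         (fresh-head x (blocks 1 d ++ ρ) (fresh-blocks x d 0 ρ))) ≤-refl
    where
      edited≡ : edited x d ρ ≡ edited-head x ++ R 1 ++ blocks 1 d ++ ρ
      edited≡ = cong (edited-head x ++_)
        (trans (cong (_++ ρ) (trans (cong R (+-comm 1 d)) (R-blocks d 1))) (++-assoc (R 1) (blocks 1 d) ρ))

  lzCount-T-step : ∀ j f (Z : Word) → lzCount (suc f) (T j) (T j ++ b ∷ Z) ≡ suc (lzCount f (T (suc j)) Z)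
  lzCount-T-step j f Z = subst (λ t → lzCount (suc f) t (t ++ b ∷ Z) ≡ suc (lzCount f (t ++ t ++ [ b ]) Z))
                           (sym (T≡a∷R j)) (lzCount-repeat f a (R j) Z b)

  blocks-suc≡ : ∀ j d (ρ : Word) → blocks j (suc d) ++ ρ ≡ a ∷ (R j ++ [ b ]) ++ blocks (suc j) d ++ ρ
  blocks-suc≡ j d ρ = trans (cong (λ t → ((t ++ [ b ]) ++ blocks (suc j) d) ++ ρ) (T≡a∷R j))
                            (++-assoc (a ∷ R j ++ [ b ]) (blocks (suc j) d) ρ)

  lzCount-blocks : ∀ d j f (ρ : Word) → length (blocks j d ++ ρ) ≤ f → Infix ρ (T (d + j)) →
                   lzCount f (T j) (blocks j d ++ ρ) ≡ d + length ρ ⊓ 1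
  lzCount-blocks zero    j f ρ le occ = lzCount-occurring f (T j) ρ le occ
  lzCount-blocks (suc d) j zero    ρ le occ with () ← subst (λ t → length t ≤ 0) (blocks-suc≡ j d ρ) le
  lzCount-blocks (suc d) j (suc f) ρ le occ = begin
    lzCount (suc f) (T j) (blocks j (suc d) ++ ρ) ≡⟨ cong (lzCount (suc f) (T j)) blocks≡ ⟩
    lzCount (suc f) (T j) (T j ++ b ∷ Z)          ≡⟨ lzCount-T-step j f Z ⟩
    suc (lzCount f (T (suc j)) Z)                  ≡⟨ cong suc (lzCount-blocks d (suc j) f ρ Z≤f occ′) ⟩
    suc (d + length ρ ⊓ 1)                         ∎
    where
      open ≡-Reasoning
      Z = blocks (suc j) d ++ ρ
      blocks≡ : blocks j (suc d) ++ ρ ≡ T j ++ b ∷ Z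
      blocks≡ = trans (++-assoc (T j ++ [ b ]) (blocks (suc j) d) ρ) (++-assoc (T j) [ b ] _)
      Z≤f : length Z ≤ f
      Z≤f = s≤s⁻¹ (≤-trans (m≤n+m (suc (length Z)) (length (T j)))
                   (subst (_≤ suc f) (trans (cong length blocks≡) (length-++ (T j))) le))
      occ′ : Infix ρ (T (d + suc j))
      occ′ = subst (λ i → Infix ρ (T i)) (sym (+-suc d j)) occ

  z77-original : ∀ d ρ → Infix ρ (T (suc d)) → z77 (original d ρ) ≡ 2 + d + length ρ ⊓ 1
  z77-original d ρ occ = begin
    lzCount (suc (length S′)) [] (a ∷ S′)  ≡⟨ lzCount-factor (length S′) [] a S′ [ a ] S′ refl
                                                (cong suc (sym (longestFrom-[] a S′ (suc (length S′))))) ⟩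
    suc (lzCount (length S′) (T 0) S′)     ≡⟨ cong (suc ∘ lzCount (length S′) (T 0)) S′≡ ⟩
    suc (lzCount (length S′) (T 0) (blocks 0 (suc d) ++ ρ))
                                           ≡⟨ cong suc (lzCount-blocks (suc d) 0 (length S′) ρ
                                                (≤-reflexive (cong length (sym S′≡))) occ′) ⟩
    2 + d + length ρ ⊓ 1                   ∎
    where
      open ≡-Reasoning
      S′ = R (suc d) ++ ρ
      d+1≡ : suc d ≡ suc d + 0
      d+1≡ = sym (+-identityʳ (suc d))
      S′≡ : S′ ≡ blocks 0 (suc d) ++ ρ
      S′≡ = cong (_++ ρ) (trans (cong R d+1≡) (R-blocks (suc d) 0))
      occ′ : Infix ρ (T (suc d + 0))
      occ′ = subst (λ i → Infix ρ (T i)) d+1≡ occ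

  length-T-suc : ∀ i → length (T (suc i)) ≡ suc (length (T i) + length (T i))
  length-T-suc i = begin
    length (T i ++ T i ++ [ b ])          ≡⟨ length-++ (T i) ⟩
    length (T i) + length (T i ++ [ b ])  ≡⟨ cong (length (T i) +_) (length-++ (T i)) ⟩
    length (T i) + (length (T i) + 1)     ≡⟨ cong (length (T i) +_) (+-comm _ 1) ⟩
    length (T i) + suc (length (T i))     ≡⟨ +-suc _ _ ⟩
    suc (length (T i) + length (T i))     ∎
    where open ≡-Reasoning

  length-T-≥ : ∀ i → suc i ≤ length (T i)
  length-T-≥ zero    = s≤s z≤n
  length-T-≥ (suc i) = subst (2 + i ≤_) (sym (length-T-suc i)) (s≤s (≤-trans (length-T-≥ i) (m≤m+n _ _)))

  length-T-mono : ∀ {i j} → i ≤ j → length (T i) ≤ length (T j)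
  length-T-mono = mono′ ∘ ≤⇒≤′
    where
      mono′ : ∀ {i j} → i ≤′ j → length (T i) ≤ length (T j)
      mono′ (≤′-reflexive refl) = ≤-refl
      mono′ (≤′-step {j} i≤′j)  = ≤-trans (mono′ i≤′j)
        (subst (length (T j) ≤_) (sym (length-T-suc j)) (≤-trans (m≤m+n _ _) (n≤1+n _)))

  -- Since |T (K+1)| = 2|T K| + 1, the intervals [|T K|, 2|T K|] cover all n ≥ 1.
  length-T-decomposition : ∀ n → 1 ≤ n → Σ ℕ λ K → Σ ℕ λ r → n ≡ length (T K) + r × r ≤ length (T K)
  length-T-decomposition (suc zero)    _ = 0 , 0 , refl , z≤n
  length-T-decomposition (suc (suc n)) _ with length-T-decomposition (suc n) (s≤s z≤n)
  ... | K , r , n≡ , r≤ with r ≟ length (T K)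
  ...   | yes refl = suc K , 0 , trans (cong suc n≡) (sym (trans (+-identityʳ _) (length-T-suc K))) , z≤n
  ...   | no  r≢   = K , suc r , trans (cong suc n≡) (sym (+-suc _ _)) , ≤∧≢⇒< r≤ r≢

  length-T-level : ∀ {K′ K r} → length (T K′) ≤ length (T K) + r → r ≤ length (T K) → K′ ≤ K
  length-T-level {K′} {K} {r} le r≤ = ≮⇒≥ λ K<K′ → <-irrefl refl (begin-strict
    length (T (suc K))                  ≤⟨ length-T-mono K<K′ ⟩
    length (T K′)                       ≤⟨ le ⟩
    length (T K) + r                    ≤⟨ +-monoʳ-≤ (length (T K)) r≤ ⟩
    length (T K) + length (T K)         <⟨ n<1+n _ ⟩
    suc (length (T K) + length (T K))   ≡⟨ length-T-suc K ⟨
    length (T (suc K))                  ∎)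
    where open ≤-Reasoning

  slack : EditKind → ℕ
  slack sub = 1
  slack ins = 1
  slack del = 2

  head-factors+slack : ∀ x → head-factors x + slack x ≡ 4
  head-factors+slack sub = refl
  head-factors+slack ins = refl
  head-factors+slack del = refl

  head-factors-≥ : ∀ x → 2 ≤ head-factors x
  head-factors-≥ sub = s≤s (s≤s z≤n)
  head-factors-≥ ins = s≤s (s≤s z≤n)
  head-factors-≥ del = s≤s (s≤s z≤n)

  length-original : ∀ d ρ → length (original d ρ) ≡ length (T (suc d)) + length ρ
  length-original d ρ = trans (cong (λ t → length (t ++ ρ)) (sym (T≡a∷R (suc d)))) (length-++ (T (suc d)))

  additive-bound : ∀ x → ASGe (3 + k) x (slack x)
  additive-bound x L M = original d [] , edited x d [] , L≤ , M≤ , one-edit x d [] , bound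
    where
      d = L + M
      z≡ : z77 (original d []) ≡ 2 + d + 0
      z≡ = z77-original d [] ([] , T (suc d) , refl)
      L≤ : L ≤ length (original d [])
      L≤ = ≤-trans (m≤m+n L M) (≤-trans (n≤1+n d) (≤-trans (n≤1+n _)
             (subst (2 + d ≤_) (sym (length-original d [])) (≤-trans (length-T-≥ (suc d)) (m≤m+n _ 0)))))
      M≤ : M ≤ z77 (original d [])
      M≤ = subst (M ≤_) (sym z≡) (≤-trans (m≤n+m M L) (≤-trans (n≤1+n d) (≤-trans (n≤1+n _) (m≤m+n _ 0))))
      bound : 2 * z77 (original d []) ≤ z77 (edited x d []) + slack x
      bound = begin
        2 * z77 (original d [])             ≡⟨ cong (2 *_) z≡ ⟩
        2 * (2 + d + 0)                     ≡⟨ double d ⟩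
        4 + (d + d)                         ≡⟨ cong (_+ (d + d)) (head-factors+slack x) ⟨
        head-factors x + slack x + (d + d)  ≡⟨ rearrange (head-factors x) (slack x) d ⟩
        head-factors x + (d + d) + slack x  ≤⟨ +-monoˡ-≤ (slack x) (z77-edited-≥ x d []) ⟩
        z77 (edited x d []) + slack x       ∎
        where
          open ≤-Reasoning
          double : ∀ d → 2 * (2 + d + 0) ≡ 4 + (d + d)
          double = solve-∀
          rearrange : ∀ h s d → h + s + (d + d) ≡ h + (d + d) + s
          rearrange = solve-∀

  ratio-at : ∀ x m d ρ → suc (4 * m) ≤ d → Infix ρ (T (suc d)) →
             (2 * m + 1) * z77 (original d ρ) ≤ (m + 1) * z77 (edited x d ρ)
  ratio-at x m d ρ le occ = begin
    (2 * m + 1) * z77 (original d ρ) ≤⟨ *-monoʳ-≤ (2 * m + 1) z≤ ⟩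
    (2 * m + 1) * (3 + d)            ≤⟨ ratio-bound m d le ⟩
    (m + 1) * (2 + (d + d))          ≤⟨ *-monoʳ-≤ (m + 1) z′≥ ⟩
    (m + 1) * z77 (edited x d ρ)     ∎
    where
      open ≤-Reasoning
      z≤ : z77 (original d ρ) ≤ 3 + d
      z≤ = subst (_≤ 3 + d) (sym (z77-original d ρ occ))
             (≤-trans (+-monoʳ-≤ (2 + d) (m⊓n≤n (length ρ) 1)) (≤-reflexive (cong (2 +_) (+-comm d 1))))
      z′≥ : 2 + (d + d) ≤ z77 (edited x d ρ)
      z′≥ = ≤-trans (+-monoˡ-≤ (d + d) (head-factors-≥ x)) (z77-edited-≥ x d ρ)

  multiplicative-bound : ∀ x → LiminfMSGe2 (3 + k) x
  multiplicative-bound x m = length (T (2 + 4 * m)) , at-length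
    where
      at-length : ∀ n → length (T (2 + 4 * m)) ≤ n →
                  Σ Word λ T₀ → Σ Word λ T₁ →
                    length T₀ ≡ n × OneEdit x T₀ T₁ × (2 * m + 1) * z77 T₀ ≤ (m + 1) * z77 T₁
      at-length n N≤n with K , r , n≡ , r≤ ← length-T-decomposition n
                                    (≤-trans (≤-trans (s≤s z≤n) (length-T-≥ (2 + 4 * m))) N≤n)
        with s≤s {n = d} 4m+1≤d ← length-T-level {2 + 4 * m} {K} (subst (length (T (2 + 4 * m)) ≤_) n≡ N≤n) r≤
        = original d ρ , edited x d ρ , length≡ , one-edit x d ρ , ratio-at x m d ρ 4m+1≤d occ
        where
          ρ = take r (T (suc d))
          occ : Infix ρ (T (suc d))
          occ = [] , drop r (T (suc d)) , sym (take++drop≡id r (T (suc d)))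
          length≡ : length (original d ρ) ≡ n
          length≡ = trans (length-original d ρ)
                      (trans (cong (length (T (suc d)) +_) (length-take-≤ (T (suc d)) r≤)) (sym n≡))

theorem12 : (k : ℕ) → 3 ≤ k →
    (LiminfMSGe2 k sub × ASGe k sub 1) ×
    (LiminfMSGe2 k ins × ASGe k ins 1) ×
    (LiminfMSGe2 k del × ASGe k del 2)
theorem12 (suc (suc (suc k))) _ =
    (multiplicative-bound sub , additive-bound sub)
  , (multiplicative-bound ins , additive-bound ins)
  , (multiplicative-bound del , additive-bound del)
  where open Construction k
theorem12 (suc zero)       (s≤s ())
theorem12 (suc (suc zero)) (s≤s (s≤s ()))
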